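{- Let $p$ be a prime and let $(\Omega,S)$ be a coherent configuration with fibers $\Omega_1,\dots,\Omega_m$ such that $(\Omega_i,S_i)\simeq C_p\wr C_p$ for each $i$ and $n_s=p$ for each $s\in\bigcup_{i\ne j}S_{ij}$. Let $R$ be the set of regular elements of $S$. Then $\bigcup_{s\in R}s$ is an equivalence relation on $\Omega$.
   Context: A coherent configuration is a pair $(\Omega,S)$ of a finite set $\Omega$ and a partition $S$ of $\Omega\times\Omega$ such that $1_\Omega$ is a union of elements of $S$, $s^\ast:=\{(\beta,\alpha)\mid(\alpha,\beta)\in s\}\in S$ for $s\in S$, and $\sigma_s\sigma_t=\sum_{u\in S}c_{st}^u\sigma_u$ with nonnegative integers $c_{st}^u$, where $\sigma_u$ is the adjacency matrix of $u$. Fibers are the sets $\Delta$ with $1_\Delta\in S$; they partition $\Omega$. $S_{ij}:=\{s\in S\mid s\subseteq\Omega_i\times\Omega_j\}$, $S_i:=S_{ii}$. For $s\in S_{ij}$, $n_s:=|\{\beta\mid(\alpha,\beta)\in s\}|$ for any $\alpha\in\Omega_i$. The complex product of $T,U\subseteq S$ is $TU:=\{s\mid c_{tu}^s>0$ for some $t\in T,u\in U\}$, singletons written without braces. An element $s\in S$ is regular if $ss^\ast s=\{s\}$. $C_p\wr C_p$ is the association scheme on $\mathbb{Z}_p\times\mathbb{Z}_p$ with relations $\{((x,y),(x+a,y))\}$ ($a\in\mathbb{Z}_p$) and $\{((x_1,y),(x_2,y+b))\}$ ($b\ne0$). -}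

module Defs where

open import Data.Nat using (ℕ; zero; suc; _<_; _+_)
open import Data.Fin using (Fin; zero; suc; toℕ; _≟_)
open import Data.Product using (Σ; ∃; _×_; _,_; proj₁; proj₂)
open import Data.Sum using (_⊎_)
open import Data.Integer as ℤ using (ℤ; +_; _-_)
open import Data.Integer.Divisibility using () renaming (_∣_ to _∣ℤ_)
open import Relation.Nullary using (¬_; Dec; does)
open import Relation.Nullary.Decidable using (_×-dec_)
open import Relation.Binary.PropositionalEquality using (_≡_; _≢_)
open import Function.Bundles using (_⤖_; _⇔_; Bijection)
open import Data.Bool using (Bool; true; false; if_then_else_)

count : ∀ {n} (P : Fin n → Set) → (∀ x → Dec (P x)) → ℕ
count {zero} P P? = 0
count {suc n} P P? =
  (if does (P? zero) then 1 else 0) + count (λ x → P (suc x)) (λ x → P? (suc x))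

-- A coherent configuration on Ω = Fin N. The partition S of Ω × Ω is given
-- by a colouring  col : Ω → Ω → Fin r  whose colour classes are the blocks;
-- every block is nonempty (witnessed by rep).
record CoherentConfiguration (N : ℕ) : Set where
  field
    r      : ℕ
    col    : Fin N → Fin N → Fin r
    rep    : Fin r → Fin N × Fin N
    rep-ok : ∀ s → col (proj₁ (rep s)) (proj₂ (rep s)) ≡ s
    -- 1_Ω is a union of blocks: a block meeting the diagonal lies in it
    diag   : ∀ a b x → col a b ≡ col x x → a ≡ b
    -- s* is a block for every block s
    trans* : ∀ a b a' b' → col a b ≡ col a' b' → col b a ≡ col b' a'
    -- σ_s σ_t is a ℕ-combination of the σ_u: the (α,β) entry of σ_s σ_t
    -- depends only on the block containing (α,β)
    const  : ∀ s t a b a' b' → col a b ≡ col a' b' →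
             count (λ g → col a g ≡ s × col g b ≡ t)
                   (λ g → (col a g ≟ s) ×-dec (col g b ≟ t))
           ≡ count (λ g → col a' g ≡ s × col g b' ≡ t)
                   (λ g → (col a' g ≟ s) ×-dec (col g b' ≟ t))

module CC {N : ℕ} (X : CoherentConfiguration N) where
  open CoherentConfiguration X public

  _* : Fin r → Fin r
  s * = col (proj₂ (rep s)) (proj₁ (rep s))

  c[_,_]^_ : Fin r → Fin r → Fin r → ℕ
  c[ s , t ]^ u =
    count (λ g → col (proj₁ (rep u)) g ≡ s × col g (proj₂ (rep u)) ≡ t)
          (λ g → (col (proj₁ (rep u)) g ≟ s) ×-dec (col g (proj₂ (rep u)) ≟ t))

  _∈[_·_] : Fin r → (Fin r → Set) → (Fin r → Set) → Set
  v ∈[ T · U ] = Σ (Fin r) λ t → Σ (Fin r) λ u → T t × U u × 0 < c[ t , u ]^ v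

  -- s is regular: s s* s = {s}
  Regular : Fin r → Set
  Regular s = ∀ v → (v ∈[ (λ w → w ∈[ (_≡ s) · (_≡ s *) ]) · (_≡ s) ]) ⇔ (v ≡ s)

  -- fibres: Ω_i is identified by its diagonal block 1_{Ω_i}; the fibre of x
  -- is the set of points y with col y y ≡ col x x
  Fiber : Fin N → Set
  Fiber x = Σ (Fin N) λ y → col y y ≡ col x x

  valency : Fin N → Fin N → ℕ
  valency a b = count (λ g → col a g ≡ col a b) (λ g → col a g ≟ col a b)

  RegRel : Fin N → Fin N → Set
  RegRel a b = Regular (col a b)

_≡ℤ_[mod_] : ℤ → ℤ → ℕ → Set
a ≡ℤ b [mod p ] = (+ p) ∣ℤ (a - b)

diff : ∀ {p} → Fin p → Fin p → ℤ
diff a b = + toℕ b - + toℕ a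

-- the two pairs ((x1,y1),(x2,y2)) and ((x1',y1'),(x2',y2')) lie in the same
-- relation of C_p ≀ C_p on Z_p × Z_p
SameWr : ∀ p → (Fin p × Fin p) → (Fin p × Fin p) → (Fin p × Fin p) → (Fin p × Fin p) → Set
SameWr p (x1 , y1) (x2 , y2) (x1' , y1') (x2' , y2') =
    (y1 ≡ y2 × y1' ≡ y2' × diff x1 x2 ≡ℤ diff x1' x2' [mod p ])
  ⊎ (y1 ≢ y2 × y1' ≢ y2' × diff y1 y2 ≡ℤ diff y1' y2' [mod p ])

module _ {N : ℕ} (X : CoherentConfiguration N) where
  open CC X
  FiberIsoWr : ℕ → Fin N → Set
  FiberIsoWr p x = Σ (Fiber x ⤖ (Fin p × Fin p)) λ f →
    ∀ (a b a' b' : Fiber x) →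
      (col (proj₁ a) (proj₁ b) ≡ col (proj₁ a') (proj₁ b'))
      ⇔ SameWr p (Bijection.to f a) (Bijection.to f b) (Bijection.to f a') (Bijection.to f b')

{-# OPTIONS --safe #-}
module Submission where

-- Call a colour s rectangular if (a,h), (g,h), (g,b) ∈ s imply (a,b) ∈ s; this
-- is the same as s s* s = {s}, and rectangular colours contain the diagonal
-- colours and are closed under transposition, so only transitivity is at issue.
-- Inside a fibre every colour of C_p ≀ C_p is rectangular, and the thin colours
-- cut each fibre into blocks of size p (points with equal second coordinate).
-- For a rectangular colour s between two fibres, the s-neighbourhood of a point,
-- which has n_s = p elements, is exactly one block.  Hence the composite of two
-- rectangular colours sends every point into a single block, and a colour with
-- that property, whose neighbourhoods have the size p of a block, is rectangular.

open import Defs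
open import Data.Nat as ℕ using (ℕ; zero; suc; _<_; z≤n; s≤s)
import Data.Nat.Properties as ℕP
import Data.Nat.Divisibility as ℕD
open import Data.Nat.Primality using (Prime; prime⇒nonTrivial)
open import Data.Fin using (Fin; zero; suc; toℕ; fromℕ<; punchIn; _≟_)
import Data.Fin.Properties as FinP
open import Data.Integer as ℤ using (ℤ; +_; _-_)
import Data.Integer.Properties as ℤP
import Data.Integer.Divisibility.Signed as ℤSigned
open import Data.Integer.Tactic.RingSolver using (solve-∀)
open import Data.Product using (∃; _×_; _,_; proj₁; proj₂; map)
open import Data.Sum using (_⊎_; inj₁; inj₂)
open import Data.Empty using (⊥-elim)
open import Relation.Nullary using (¬_; Dec; yes; no)
open import Relation.Nullary.Decidable using (decidable-stable)
open import Relation.Binary.PropositionalEquality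
open import Relation.Binary.Structures using (IsEquivalence)
open import Axiom.UniquenessOfIdentityProofs using (module Decidable⇒UIP)
open import Function.Base using (_∘_; id)
open import Function.Bundles using (Bijection; Equivalence; mk⇔)

enumerate : ∀ {n} (P : Fin n → Set) (P? : ∀ x → Dec (P x)) → Fin (count P P?) → ∃ P
enumerate {suc n} P P? k with P? zero
enumerate {suc n} P P? zero    | yes P0 = zero , P0
enumerate {suc n} P P? (suc k) | yes _  = map suc id (enumerate (λ x → P (suc x)) (λ x → P? (suc x)) k)
enumerate {suc n} P P? k       | no _   = map suc id (enumerate (λ x → P (suc x)) (λ x → P? (suc x)) k)

enumerate-injective : ∀ {n} (P : Fin n → Set) (P? : ∀ x → Dec (P x)) {k l : Fin (count P P?)} →
                      proj₁ (enumerate P P? k) ≡ proj₁ (enumerate P P? l) → k ≡ l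
enumerate-injective {suc n} P P? {k} {l} eq with P? zero
enumerate-injective {suc n} P P? {zero}  {zero}  eq | yes _ = refl
enumerate-injective {suc n} P P? {zero}  {suc l} () | yes _
enumerate-injective {suc n} P P? {suc k} {zero}  () | yes _
enumerate-injective {suc n} P P? {suc k} {suc l} eq | yes _ =
  cong suc (enumerate-injective (λ x → P (suc x)) (λ x → P? (suc x)) (FinP.suc-injective eq))
enumerate-injective {suc n} P P? eq | no _ =
  enumerate-injective (λ x → P (suc x)) (λ x → P? (suc x)) (FinP.suc-injective eq)

index : ∀ {n} (P : Fin n → Set) (P? : ∀ x → Dec (P x)) (x : Fin n) → P x → Fin (count P P?)
index {suc n} P P? x Px with P? zero
index {suc n} P P? zero    Px | yes _  = zero
index {suc n} P P? (suc x) Px | yes _  = suc (index (λ x → P (suc x)) (λ x → P? (suc x)) x Px)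
index {suc n} P P? zero    Px | no ¬P0 = ⊥-elim (¬P0 Px)
index {suc n} P P? (suc x) Px | no _   = index (λ x → P (suc x)) (λ x → P? (suc x)) x Px

index-injective : ∀ {n} (P : Fin n → Set) (P? : ∀ x → Dec (P x)) {x y : Fin n} (Px : P x) (Py : P y) →
                  index P P? x Px ≡ index P P? y Py → x ≡ y
index-injective {suc n} P P? {x} {y} Px Py eq with P? zero
index-injective {suc n} P P? {zero}  {zero}  Px Py eq | yes _ = refl
index-injective {suc n} P P? {suc x} {suc y} Px Py eq | yes _ =
  cong suc (index-injective (λ x → P (suc x)) (λ x → P? (suc x)) Px Py (FinP.suc-injective eq))
index-injective {suc n} P P? {zero}  {y}     Px Py eq | no ¬P0 = ⊥-elim (¬P0 Px)
index-injective {suc n} P P? {suc x} {zero}  Px Py eq | no ¬P0 = ⊥-elim (¬P0 Py)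
index-injective {suc n} P P? {suc x} {suc y} Px Py eq | no _ =
  cong suc (index-injective (λ x → P (suc x)) (λ x → P? (suc x)) Px Py eq)

count>0⇒∃ : ∀ {n} (P : Fin n → Set) (P? : ∀ x → Dec (P x)) → 0 < count P P? → ∃ P
count>0⇒∃ P P? 0<count = enumerate P P? (fromℕ< 0<count)

∃⇒count>0 : ∀ {n} (P : Fin n → Set) (P? : ∀ x → Dec (P x)) (x : Fin n) → P x → 0 < count P P?
∃⇒count>0 P P? x Px with count P P? | index P P? x Px
... | suc _ | _ = s≤s z≤n

count-< : ∀ {n k} (P : Fin n → Set) (P? : ∀ x → Dec (P x)) (Q : Fin n → Set) →
          (h : ∀ x → Q x → Fin k) → (∀ {x y} Qx Qy → h x Qx ≡ h y Qy → x ≡ y) →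
          (∀ x → P x → Q x) → (w : Fin n) → Q w → ¬ P w → count P P? < k
count-< {n} {k} P P? Q h h-inj P⊆Q w Qw ¬Pw = FinP.injective⇒≤ {f = g} g-injective
  where
  point : Fin (suc (count P P?)) → Fin n
  point zero    = w
  point (suc i) = proj₁ (enumerate P P? i)
  point∈Q : ∀ i → Q (point i)
  point∈Q zero    = Qw
  point∈Q (suc i) = P⊆Q _ (proj₂ (enumerate P P? i))
  point-injective : ∀ {i j} → point i ≡ point j → i ≡ j
  point-injective {zero}  {zero}  _  = refl
  point-injective {zero}  {suc j} eq = ⊥-elim (¬Pw (subst P (sym eq) (proj₂ (enumerate P P? j))))
  point-injective {suc i} {zero}  eq = ⊥-elim (¬Pw (subst P eq (proj₂ (enumerate P P? i))))
  point-injective {suc i} {suc j} eq = cong suc (enumerate-injective P P? eq)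
  g : Fin (suc (count P P?)) → Fin k
  g i = h (point i) (point∈Q i)
  g-injective : ∀ {i j} → g i ≡ g j → i ≡ j
  g-injective eq = point-injective (h-inj _ _ eq)

<-count : ∀ {n k} (P : Fin n → Set) (P? : ∀ x → Dec (P x)) (f : Fin k → Fin n) →
          (∀ {i j} → f i ≡ f j → i ≡ j) → (∀ i → P (f i)) →
          (w : Fin n) → P w → (∀ i → f i ≢ w) → k < count P P?
<-count {n} {k} P P? f f-inj Pf w Pw f≢w = FinP.injective⇒≤ {f = g} g-injective
  where
  point : Fin (suc k) → Fin n
  point zero    = w
  point (suc i) = f i
  point∈P : ∀ i → P (point i)
  point∈P zero    = Pw
  point∈P (suc i) = Pf i
  point-injective : ∀ {i j} → point i ≡ point j → i ≡ j
  point-injective {zero}  {zero}  _  = refl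
  point-injective {zero}  {suc j} eq = ⊥-elim (f≢w j (sym eq))
  point-injective {suc i} {zero}  eq = ⊥-elim (f≢w i eq)
  point-injective {suc i} {suc j} eq = cong suc (f-inj eq)
  g : Fin (suc k) → Fin (count P P?)
  g i = index P P? (point i) (point∈P i)
  g-injective : ∀ {i j} → g i ≡ g j → i ≡ j
  g-injective eq = point-injective (index-injective P P? _ _ eq)

another : ∀ {n} → 1 < n → (k : Fin n) → ∃ λ k' → k' ≢ k
another {suc (suc _)} _ k = punchIn k zero , FinP.punchInᵢ≢i k zero
another {suc zero} (s≤s ()) _

module Congruence (p : ℕ) where

  ≡ℤ-refl : ∀ i → i ≡ℤ i [mod p ]
  ≡ℤ-refl i = subst (λ j → p ℕD.∣ ℤ.∣ j ∣) (sym (ℤP.+-inverseʳ i)) (p ℕD.∣0)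

  ≡ℤ-sym : ∀ i j → i ≡ℤ j [mod p ] → j ≡ℤ i [mod p ]
  ≡ℤ-sym i j = subst (p ℕD.∣_) (ℤP.∣i-j∣≡∣j-i∣ i j)

  ≡ℤ-trans : ∀ i j k → i ≡ℤ j [mod p ] → j ≡ℤ k [mod p ] → i ≡ℤ k [mod p ]
  ≡ℤ-trans i j k i≡j j≡k = ℤSigned.∣⇒∣ᵤ (subst (ℤSigned._∣_ (+ p)) (telescope i j k)
    (ℤSigned.∣m∣n⇒∣m+n (ℤSigned.∣ᵤ⇒∣ {i = i - j} i≡j) (ℤSigned.∣ᵤ⇒∣ {i = j - k} j≡k)))
    where
    telescope : ∀ i j k → (i - j) ℤ.+ (j - k) ≡ i - k
    telescope = solve-∀

  fin-≡ℤ⇒≡ : {a b : Fin p} → (+ toℕ a) ≡ℤ (+ toℕ b) [mod p ] → a ≡ b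
  fin-≡ℤ⇒≡ {a} {b} p∣a-b =
    FinP.toℕ-injective (ℤP.+-injective (ℤP.i-j≡0⇒i≡j _ _ (ℤP.∣i∣≡0⇒i≡0 (small-multiple ∣a-b∣<p p∣a-b))))
    where
    small-multiple : ∀ {m} → m < p → p ℕD.∣ m → m ≡ 0
    small-multiple {zero}  _   _   = refl
    small-multiple {suc m} m<p p∣m = ⊥-elim (ℕD.>⇒∤ m<p p∣m)
    ∣a-b∣<p : ℤ.∣ + toℕ a - + toℕ b ∣ < p
    ∣a-b∣<p = ℕP.≤-<-trans (subst (ℕ._≤ toℕ a ℕ.⊔ toℕ b)
                                  (cong ℤ.∣_∣ (sym (ℤP.m-n≡m⊖n (toℕ a) (toℕ b))))
                                  (ℤP.∣m⊝n∣≤m⊔n (toℕ a) (toℕ b)))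
                           (ℕP.⊔-lub (FinP.toℕ<n a) (FinP.toℕ<n b))

  diff-cancelʳ : ∀ (a b c : Fin p) → diff a c ≡ℤ diff b c [mod p ] → a ≡ b
  diff-cancelʳ a b c eq =
    sym (fin-≡ℤ⇒≡ (subst (λ j → p ℕD.∣ ℤ.∣ j ∣) (cancel (+ toℕ a) (+ toℕ b) (+ toℕ c)) eq))
    where
    cancel : ∀ a b c → (c - a) - (c - b) ≡ b - a
    cancel = solve-∀

  diff-cancelˡ : ∀ (a b c : Fin p) → diff c a ≡ℤ diff c b [mod p ] → a ≡ b
  diff-cancelˡ a b c eq =
    fin-≡ℤ⇒≡ (subst (λ j → p ℕD.∣ ℤ.∣ j ∣) (cancel (+ toℕ a) (+ toℕ b) (+ toℕ c)) eq)
    where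
    cancel : ∀ a b c → (a - c) - (b - c) ≡ a - b
    cancel = solve-∀

-- The second coordinate of a point of C_p ≀ C_p is its level; the thin relations
-- of the scheme are those joining points of equal level.
module WreathScheme (p : ℕ) where
  open Congruence p

  Point : Set
  Point = Fin p × Fin p

  sameWr-rectangle : (A H G Y : Point) → SameWr p A H G H → SameWr p G Y A H →
                     A ≡ G ⊎ SameWr p A Y A H
  sameWr-rectangle (xa , ya) (xh , yh) (xg , yg) _ (inj₁ (ya≡yh , yg≡yh , xa-xh≡xg-xh)) _ =
    inj₁ (cong₂ _,_ (diff-cancelʳ xa xg xh xa-xh≡xg-xh) (trans ya≡yh (sym yg≡yh)))
  sameWr-rectangle _ _ _ _ (inj₂ (ya≢yh , _ , _)) (inj₁ (_ , ya≡yh , _)) = ⊥-elim (ya≢yh ya≡yh)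
  sameWr-rectangle (_ , ya) (_ , yh) (_ , yg) _ (inj₂ (_ , _ , ya-yh≡yg-yh)) (inj₂ GY~AH)
    with diff-cancelʳ ya yg yh ya-yh≡yg-yh
  ... | refl = inj₂ (inj₂ GY~AH)

  sameWr-functional : (A B B' W W' : Point) → proj₂ W ≡ proj₂ W' →
                      SameWr p A B W W' → SameWr p A B' W W' → B ≡ B'
  sameWr-functional _ _ _ _ _ yw≡yw' (inj₂ (_ , yw≢yw' , _)) _ = ⊥-elim (yw≢yw' yw≡yw')
  sameWr-functional _ _ _ _ _ yw≡yw' (inj₁ _) (inj₂ (_ , yw≢yw' , _)) = ⊥-elim (yw≢yw' yw≡yw')
  sameWr-functional (xa , _) (xb , _) (xb' , _) (xw , _) (xw' , _) _
                    (inj₁ (ya≡yb , _ , xa-xb≡xw-xw')) (inj₁ (ya≡yb' , _ , xa-xb'≡xw-xw')) =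
    cong₂ _,_ (diff-cancelˡ xb xb' xa (≡ℤ-trans (diff xa xb) (diff xw xw') (diff xa xb')
                                                xa-xb≡xw-xw' (≡ℤ-sym (diff xa xb') (diff xw xw') xa-xb'≡xw-xw')))
              (trans (sym ya≡yb) ya≡yb')

  sameWr-sameLevel : (W W'' W' : Point) → proj₂ W ≢ proj₂ W' → proj₂ W'' ≡ proj₂ W' →
                     SameWr p W W'' W W'
  sameWr-sameLevel (_ , yw) _ (_ , yw') yw≢yw' refl = inj₂ (yw≢yw' , yw≢yw' , ≡ℤ-refl (diff yw yw'))

  sameWr-preserves-level : (B B' G G' : Point) → proj₂ B ≡ proj₂ B' →
                           SameWr p B G B' G' → proj₂ G ≡ proj₂ G'
  sameWr-preserves-level _ _ _ _ yb≡yb' (inj₁ (yb≡yg , yb'≡yg' , _)) = trans (sym yb≡yg) (trans yb≡yb' yb'≡yg')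
  sameWr-preserves-level (_ , yb) _ (_ , yg) (_ , yg') refl (inj₂ (_ , _ , yb-yg≡yb-yg')) =
    diff-cancelˡ yg yg' yb yb-yg≡yb-yg'

module Rectangularity {N : ℕ} (X : CoherentConfiguration N) where
  open CC X

  fibreOf : Fin N → Fin r
  fibreOf x = col x x

  Path : Fin r → Fin r → Fin N → Fin N → Set
  Path s t a b = ∃ λ g → col a g ≡ s × col g b ≡ t

  path-transfer : ∀ {s t a b a' b'} → col a b ≡ col a' b' → Path s t a b → Path s t a' b'
  path-transfer {s} {t} {a} {b} {a'} {b'} ab≡a'b' (g , agb) =
    count>0⇒∃ _ _ (subst (0 <_) (const s t a b a' b' ab≡a'b') (∃⇒count>0 _ _ g agb))

  c>0⇒path : ∀ {s t v a b} → 0 < c[ s , t ]^ v → col a b ≡ v → Path s t a b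
  c>0⇒path {v = v} c>0 ab≡v = path-transfer (trans (rep-ok v) (sym ab≡v)) (count>0⇒∃ _ _ c>0)

  path⇒c>0 : ∀ {s t v a b} → col a b ≡ v → Path s t a b → 0 < c[ s , t ]^ v
  path⇒c>0 {v = v} ab≡v path with path-transfer (trans ab≡v (sym (rep-ok v))) path
  ... | g , agb = ∃⇒count>0 _ _ g agb

  col-transpose : ∀ {a b s} → col a b ≡ s → col b a ≡ s *
  col-transpose {a} {b} {s} ab≡s = trans* a b (proj₁ (rep s)) (proj₂ (rep s)) (trans ab≡s (sym (rep-ok s)))

  *-involutive : ∀ s → (s *) * ≡ s
  *-involutive s = trans (sym (col-transpose refl)) (rep-ok s)

  fibre-source : ∀ {x y a b} → col x y ≡ col a b → fibreOf x ≡ fibreOf a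
  fibre-source {x} {a = a} {b} xy≡ab with path-transfer (sym xy≡ab) (a , refl , refl)
  ... | g , xg≡aa , _ with diag x g a xg≡aa
  ... | refl = xg≡aa

  fibre-target : ∀ {x y a b} → col x y ≡ col a b → fibreOf y ≡ fibreOf b
  fibre-target {x} {y} {a} {b} xy≡ab = fibre-source (trans* x y a b xy≡ab)

  col⇒fibre≡ : ∀ {x y a b} → col x y ≡ col a b → fibreOf a ≡ fibreOf b → fibreOf y ≡ fibreOf x
  col⇒fibre≡ xy≡ab a∈b = trans (fibre-target xy≡ab) (trans (sym a∈b) (sym (fibre-source xy≡ab)))

  col⇒fibre≢ : ∀ {x y a b} → col x y ≡ col a b → fibreOf a ≢ fibreOf b → fibreOf x ≢ fibreOf y
  col⇒fibre≢ xy≡ab a≢b x∈y = a≢b (trans (sym (fibre-source xy≡ab)) (trans x∈y (fibre-target xy≡ab)))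

  Rectangular : Fin r → Set
  Rectangular s = ∀ a h g b → col a h ≡ s → col g h ≡ s → col g b ≡ s → col a b ≡ s

  regular⇒rectangular : ∀ s → Regular s → Rectangular s
  regular⇒rectangular s reg a h g b ah≡s gh≡s gb≡s = Equivalence.to (reg (col a b)) ab∈ss*s
    where
    ab∈ss*s : col a b ∈[ (λ w → w ∈[ (_≡ s) · (_≡ s *) ]) · (_≡ s) ]
    ab∈ss*s = col a g , s , (s , s * , refl , refl , path⇒c>0 refl (h , ah≡s , col-transpose gh≡s))
            , refl , path⇒c>0 refl (g , refl , gb≡s)

  rectangular⇒regular : ∀ s → Rectangular s → Regular s
  rectangular⇒regular s rect v = mk⇔ ss*s⊆s s⊆ss*s
    where
    ss*s⊆s : v ∈[ (λ w → w ∈[ (_≡ s) · (_≡ s *) ]) · (_≡ s) ] → v ≡ s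
    ss*s⊆s (_ , _ , (_ , _ , refl , refl , c₁>0) , refl , c₂>0) with c>0⇒path c₂>0 (rep-ok v)
    ... | g , ag , gb≡s with c>0⇒path c₁>0 ag
    ...   | h , ah≡s , hg≡s* =
      trans (sym (rep-ok v)) (rect _ h g _ ah≡s (trans (col-transpose hg≡s*) (*-involutive s)) gb≡s)
    s⊆ss*s : v ≡ s → v ∈[ (λ w → w ∈[ (_≡ s) · (_≡ s *) ]) · (_≡ s) ]
    s⊆ss*s refl = fibreOf a , s , (s , s * , refl , refl , path⇒c>0 refl (b , rep-ok s , refl))
                , refl , path⇒c>0 (rep-ok s) (a , refl , rep-ok s)
      where
      a = proj₁ (rep s)
      b = proj₂ (rep s)

  fibre-rectangular : ∀ x → Rectangular (fibreOf x)
  fibre-rectangular x a h g b ah≡xx gh≡xx gb≡xx with diag a h x ah≡xx | diag g h x gh≡xx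
  ... | refl | refl = gb≡xx

  transpose-rectangular : ∀ a b → Rectangular (col a b) → Rectangular (col b a)
  transpose-rectangular a b rect c h g d ch≡ba gh≡ba gd≡ba =
    trans* d c a b (rect d g h c (trans* g d b a gd≡ba) (trans* g h b a gh≡ba) (trans* c h b a ch≡ba))

module WreathFibres {N : ℕ} (X : CoherentConfiguration N) {p : ℕ} (1<p : 1 < p)
  (wr : ∀ x → FiberIsoWr X p x)
  (valency≡p : ∀ a b → CoherentConfiguration.col X a a ≢ CoherentConfiguration.col X b b →
               CC.valency X a b ≡ p) where
  open CC X
  open Rectangularity X
  open WreathScheme p

  coord : (o w : Fin N) → fibreOf w ≡ fibreOf o → Point
  coord o w w∈o = Bijection.to (proj₁ (wr o)) (w , w∈o)

  level : (o w : Fin N) → fibreOf w ≡ fibreOf o → Fin p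
  level o w w∈o = proj₂ (coord o w w∈o)

  coord-injective : ∀ o {w w'} w∈o w'∈o → coord o w w∈o ≡ coord o w' w'∈o → w ≡ w'
  coord-injective o _ _ eq = cong proj₁ (Bijection.injective (proj₁ (wr o)) eq)

  coord-cong : ∀ o {w w'} w∈o w'∈o → w ≡ w' → coord o w w∈o ≡ coord o w' w'∈o
  coord-cong o w∈o w'∈o refl = cong (coord o _) (Decidable⇒UIP.≡-irrelevant _≟_ w∈o w'∈o)

  pointAt : (o : Fin N) → Point → Fiber o
  pointAt o = Bijection.to⁻ (proj₁ (wr o))

  coord-pointAt : ∀ o c → coord o (proj₁ (pointAt o c)) (proj₂ (pointAt o c)) ≡ c
  coord-pointAt o = proj₂ ∘ Bijection.strictlySurjective (proj₁ (wr o))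

  col⇒sameWr : ∀ o a b a' b' a∈o b∈o a'∈o b'∈o → col a b ≡ col a' b' →
               SameWr p (coord o a a∈o) (coord o b b∈o) (coord o a' a'∈o) (coord o b' b'∈o)
  col⇒sameWr o a b a' b' a∈o b∈o a'∈o b'∈o =
    Equivalence.to (proj₂ (wr o) (a , a∈o) (b , b∈o) (a' , a'∈o) (b' , b'∈o))

  sameWr⇒col : ∀ o a b a' b' a∈o b∈o a'∈o b'∈o →
               SameWr p (coord o a a∈o) (coord o b b∈o) (coord o a' a'∈o) (coord o b' b'∈o) →
               col a b ≡ col a' b'
  sameWr⇒col o a b a' b' a∈o b∈o a'∈o b'∈o =
    Equivalence.from (proj₂ (wr o) (a , a∈o) (b , b∈o) (a' , a'∈o) (b' , b'∈o))

  Thin : Fin r → Set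
  Thin s = ∀ a b b' → col a b ≡ s → col a b' ≡ s → b ≡ b'

  SameBlock : Fin N → Fin N → Set
  SameBlock w w' = fibreOf w' ≡ fibreOf w × Thin (col w w')

  sameBlock-refl : ∀ w → SameBlock w w
  sameBlock-refl w = refl , λ a b b' ab≡ww ab'≡ww → trans (sym (diag a b w ab≡ww)) (diag a b' w ab'≡ww)

  sameLevel⇒sameBlock : ∀ o w w' w∈o w'∈o → level o w w∈o ≡ level o w' w'∈o → SameBlock w w'
  sameLevel⇒sameBlock o w w' w∈o w'∈o levels≡ = trans w'∈o (sym w∈o) , thin
    where
    thin : Thin (col w w')
    thin a b b' ab≡ww' ab'≡ww' =
      coord-injective o b∈o b'∈o
        (sameWr-functional (coord o a a∈o) (coord o b b∈o) (coord o b' b'∈o) (coord o w w∈o) (coord o w' w'∈o)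
          levels≡ (col⇒sameWr o a b w w' a∈o b∈o w∈o w'∈o ab≡ww') (col⇒sameWr o a b' w w' a∈o b'∈o w∈o w'∈o ab'≡ww'))
      where
      a∈o = trans (fibre-source ab≡ww') w∈o
      b∈o = trans (fibre-target ab≡ww') w'∈o
      b'∈o = trans (fibre-target ab'≡ww') w'∈o

  -- A point of the level of w' other than w' is related to w like w' (if w is on
  -- another level), and a thin colour then forces it to be w'.
  sameBlock⇒sameLevel : ∀ o w w' w∈o w'∈o → SameBlock w w' → level o w w∈o ≡ level o w' w'∈o
  sameBlock⇒sameLevel o w w' w∈o w'∈o (_ , thin) =
    decidable-stable (level o w w∈o ≟ level o w' w'∈o) λ levels≢ →
      x≢x' (cong proj₁ (trans (sym (coord-pointAt o c))
                              (coord-cong o _ w'∈o (thin w w'' w' (ww''≡ww' levels≢) refl))))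
    where
    x' = proj₁ (coord o w' w'∈o)
    x = proj₁ (another 1<p x')
    x≢x' = proj₂ (another 1<p x')
    c = x , level o w' w'∈o
    w'' = proj₁ (pointAt o c)
    ww''≡ww' : level o w w∈o ≢ level o w' w'∈o → col w w'' ≡ col w w'
    ww''≡ww' levels≢ = sameWr⇒col o w w'' w w' w∈o _ w∈o w'∈o
      (sameWr-sameLevel (coord o w w∈o) _ (coord o w' w'∈o) levels≢ (cong proj₂ (coord-pointAt o c)))

  sameBlock-transport : ∀ β β' γ γ' → fibreOf γ ≡ fibreOf β → SameBlock β β' →
                        col β γ ≡ col β' γ' → SameBlock γ γ'
  sameBlock-transport β β' γ γ' γ∈β β~β' βγ≡β'γ' =
    sameLevel⇒sameBlock β γ γ' γ∈β γ'∈β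
      (sameWr-preserves-level (coord β β refl) (coord β β' β'∈β) (coord β γ γ∈β) (coord β γ' γ'∈β)
        (sameBlock⇒sameLevel β β β' refl β'∈β β~β') (col⇒sameWr β β γ β' γ' refl γ∈β β'∈β γ'∈β βγ≡β'γ'))
    where
    β'∈β = proj₁ β~β'
    γ'∈β = trans (fibre-target (sym βγ≡β'γ')) γ∈β

  intraFibre-rectangular : ∀ a c → fibreOf a ≡ fibreOf c → Rectangular (col a c)
  intraFibre-rectangular a c a∈c x h g y xh≡ac gh≡ac gy≡ac =
    closes (sameWr-rectangle (coord x x refl) (coord x h h∈x) (coord x g g∈x) (coord x y y∈x)
             (col⇒sameWr x x h g h refl h∈x g∈x h∈x (trans xh≡ac (sym gh≡ac)))
             (col⇒sameWr x g y x h g∈x y∈x refl h∈x (trans gy≡ac (sym xh≡ac))))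
    where
    h∈x = col⇒fibre≡ xh≡ac a∈c
    g∈x = fibre-source (trans gh≡ac (sym xh≡ac))
    y∈x = trans (fibre-target (trans gy≡ac (sym xh≡ac))) h∈x
    closes : coord x x refl ≡ coord x g g∈x ⊎ SameWr p (coord x x refl) (coord x y y∈x) (coord x x refl) (coord x h h∈x) →
             col x y ≡ col a c
    closes (inj₁ x≡g) with coord-injective x refl g∈x x≡g
    ... | refl = gy≡ac
    closes (inj₂ xy~xh) = trans (sameWr⇒col x x y x h refl y∈x refl h∈x xy~xh) xh≡ac

  -- The neighbourhood {w | col x w ≡ col x z} has n_{col x z} = p points, as
  -- many as a block, so once it lies in the block of z it fills that block.
  block⊆neighbourhood : ∀ x z → fibreOf x ≢ fibreOf z → (∀ w → col x w ≡ col x z → SameBlock z w) →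
                        ∀ w → SameBlock z w → col x w ≡ col x z
  block⊆neighbourhood x z x≢z neighbourhood⊆block w z~w =
    decidable-stable (col x w ≟ col x z) λ xw≢xz →
      ℕP.<-irrefl (valency≡p x z x≢z)
        (count-< (λ g → col x g ≡ col x z) (λ g → col x g ≟ col x z) (SameBlock z)
                 abscissa abscissa-injective neighbourhood⊆block w z~w xw≢xz)
    where
    abscissa : ∀ g → SameBlock z g → Fin p
    abscissa g z~g = proj₁ (coord z g (proj₁ z~g))
    abscissa-injective : ∀ {g g'} z~g z~g' → abscissa g z~g ≡ abscissa g' z~g' → g ≡ g'
    abscissa-injective {g} {g'} z~g z~g' abscissæ≡ = coord-injective z _ _
      (cong₂ _,_ abscissæ≡ (trans (sym (sameBlock⇒sameLevel z z g refl _ z~g))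
                                  (sameBlock⇒sameLevel z z g' refl _ z~g')))

  -- If some z' with col x z' ≡ col x z lay off the block of z, rectangularity
  -- would put the whole block of z' next to z in the neighbourhood: p + 1 points.
  neighbourhood⊆block : ∀ x z z' → fibreOf x ≢ fibreOf z → Rectangular (col x z) →
                        col x z' ≡ col x z → SameBlock z z'
  neighbourhood⊆block x z z' x≢z rect xz'≡xz =
    sameLevel⇒sameBlock z z z' refl z'∈z
      (decidable-stable (level z z refl ≟ level z z' z'∈z) λ levels≢ →
        ℕP.<-irrefl (sym (valency≡p x z x≢z))
          (<-count (λ g → col x g ≡ col x z) (λ g → col x g ≟ col x z)
                   onLevel onLevel-injective (onLevel∈neighbourhood levels≢) z refl (onLevel≢z levels≢)))
    where
    z'∈z = fibre-target xz'≡xz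
    c : Fin p → Point
    c k = k , level z z' z'∈z
    onLevel : Fin p → Fin N
    onLevel k = proj₁ (pointAt z (c k))
    coord-onLevel : ∀ k → coord z (onLevel k) _ ≡ c k
    coord-onLevel k = coord-pointAt z (c k)
    onLevel-injective : ∀ {k l} → onLevel k ≡ onLevel l → k ≡ l
    onLevel-injective {k} {l} eq =
      cong proj₁ (trans (sym (coord-onLevel k)) (trans (coord-cong z _ _ eq) (coord-onLevel l)))
    onLevel≢z : level z z refl ≢ level z z' z'∈z → ∀ k → onLevel k ≢ z
    onLevel≢z levels≢ k eq = levels≢ (cong proj₂ (trans (coord-cong z refl _ (sym eq)) (coord-onLevel k)))
    zw≡zz' : level z z refl ≢ level z z' z'∈z → ∀ k → col z (onLevel k) ≡ col z z'
    zw≡zz' levels≢ k = sameWr⇒col z z (onLevel k) z z' refl _ refl z'∈z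
      (sameWr-sameLevel (coord z z refl) _ (coord z z' z'∈z) levels≢ (cong proj₂ (coord-onLevel k)))
    onLevel∈neighbourhood : level z z refl ≢ level z z' z'∈z → ∀ k → col x (onLevel k) ≡ col x z
    onLevel∈neighbourhood levels≢ k =
      let x' , zx'≡zx , x'w≡xz = path-transfer (sym (zw≡zz' levels≢ k)) (x , refl , xz'≡xz)
      in  rect x z x' (onLevel k) refl (trans* z x' z x zx'≡zx) x'w≡xz

  rectangular-block-invariant : ∀ β γ β' → fibreOf β ≢ fibreOf γ → Rectangular (col γ β) →
                                SameBlock β β' → col β' γ ≡ col β γ
  rectangular-block-invariant β γ β' β≢γ rect β~β' =
    trans* γ β' γ β (block⊆neighbourhood γ β γ≢β (λ w γw≡γβ → neighbourhood⊆block γ β w γ≢β rect γw≡γβ) β' β~β')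
    where
    γ≢β : fibreOf γ ≢ fibreOf β
    γ≢β = β≢γ ∘ sym

  IntoBlocks : Fin r → Set
  IntoBlocks u = ∀ α γ γ' → col α γ ≡ u → col α γ' ≡ u → SameBlock γ γ'

  intoBlocks⇒rectangular : ∀ a c → fibreOf a ≢ fibreOf c → IntoBlocks (col a c) → Rectangular (col a c)
  intoBlocks⇒rectangular a c a≢c into x h g y xh≡ac gh≡ac gy≡ac =
    trans (block⊆neighbourhood x h x≢h (λ w xw≡xh → into x h w xh≡ac (trans xw≡xh xh≡ac)) y
                               (into g h y gh≡ac gy≡ac))
          xh≡ac
    where
    x≢h = col⇒fibre≢ xh≡ac a≢c

  composite-intoBlocks : ∀ a b c → fibreOf a ≢ fibreOf c → Rectangular (col a b) → Rectangular (col b c) →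
                         IntoBlocks (col a c)
  composite-intoBlocks a b c a≢c rect-ab rect-bc α γ γ' αγ≡ac αγ'≡ac =
    via (path-transfer (sym αγ≡ac) (b , refl , refl)) (path-transfer (sym αγ'≡ac) (b , refl , refl))
    where
    via : Path (col a b) (col b c) α γ → Path (col a b) (col b c) α γ' → SameBlock γ γ'
    via (β , αβ≡ab , βγ≡bc) (β' , αβ'≡ab , β'γ'≡bc) = γ~γ' (fibreOf b ≟ fibreOf c)
      where
      β~β' : Dec (fibreOf a ≡ fibreOf b) → SameBlock β β'
      β~β' (yes a∈b) = sameBlock-transport α α β β' (col⇒fibre≡ αβ≡ab a∈b) (sameBlock-refl α)
                                           (trans αβ≡ab (sym αβ'≡ab))
      β~β' (no a≢b)  = neighbourhood⊆block α β β' (col⇒fibre≢ αβ≡ab a≢b)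
                                           (subst Rectangular (sym αβ≡ab) rect-ab) (trans αβ'≡ab (sym αβ≡ab))
      γ~γ' : Dec (fibreOf b ≡ fibreOf c) → SameBlock γ γ'
      γ~γ' (yes b∈c) = sameBlock-transport β β' γ γ' (col⇒fibre≡ βγ≡bc b∈c) (β~β' (fibreOf a ≟ fibreOf b))
                                           (trans βγ≡bc (sym β'γ'≡bc))
      γ~γ' (no b≢c)  = neighbourhood⊆block β' γ γ' (col⇒fibre≢ β'γ≡bc b≢c)
                                           (subst Rectangular (sym β'γ≡bc) rect-bc) (trans β'γ'≡bc (sym β'γ≡bc))
        where
        β'γ≡bc : col β' γ ≡ col b c
        β'γ≡bc = trans (rectangular-block-invariant β γ β' (col⇒fibre≢ βγ≡bc b≢c)
                         (transpose-rectangular β γ (subst Rectangular (sym βγ≡bc) rect-bc))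
                         (β~β' (fibreOf a ≟ fibreOf b)))
                       βγ≡bc

  rectangular-trans : ∀ a b c → Rectangular (col a b) → Rectangular (col b c) → Rectangular (col a c)
  rectangular-trans a b c rect-ab rect-bc with fibreOf a ≟ fibreOf c
  ... | yes a∈c = intraFibre-rectangular a c a∈c
  ... | no a≢c  = intoBlocks⇒rectangular a c a≢c (composite-intoBlocks a b c a≢c rect-ab rect-bc)

lemma3p3 : (p : ℕ) → Prime p → (N : ℕ) → (X : CoherentConfiguration N) →
           (∀ x → FiberIsoWr X p x) →
           (∀ a b → CoherentConfiguration.col X a a ≢ CoherentConfiguration.col X b b →
                    CC.valency X a b ≡ p) →
           IsEquivalence (CC.RegRel X)
lemma3p3 p p-prime N X wr valency≡p = record
  { refl  = λ {x} → rectangular⇒regular _ (fibre-rectangular x)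
  ; sym   = λ {a} {b} reg → rectangular⇒regular _ (transpose-rectangular a b (regular⇒rectangular _ reg))
  ; trans = λ {a} {b} {c} reg-ab reg-bc → rectangular⇒regular _
              (rectangular-trans a b c (regular⇒rectangular _ reg-ab) (regular⇒rectangular _ reg-bc))
  }
  where
  open Rectangularity X
  open WreathFibres X (ℕ.nonTrivial⇒n>1 p {{prime⇒nonTrivial p-prime}}) wr valency≡p
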